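{- For every $k\geq 2$, there exists a $k$-uniform block graph $G$ in which each block contains at most two cut-vertices and $\overrightarrow{\chi}(G)\geq k+1$.
   Context: An orientation $D$ of a graph $G$ replaces each edge by exactly one of its two possible arcs; $d^-_D(v)$ is the indegree of $v$. $D$ is proper if adjacent vertices have distinct indegrees; a $k$-orientation has maximum indegree at most $k$. $\overrightarrow{\chi}(G)$ is the minimum $k$ such that $G$ admits a proper $k$-orientation. A block graph is a graph whose 2-connected components (blocks) are complete graphs; it is $k$-uniform if every block has exactly $k=\omega(G)$ vertices. -}

module Defs where

open import Data.Nat using (ℕ; zero; suc; _+_; _≤_)
open import Data.Fin using (Fin; zero; suc)
open import Data.Bool using (Bool; true; false; not; _∧_; if_then_else_)
open import Data.Product using (Σ; ∃; _×_; _,_)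
open import Relation.Binary.PropositionalEquality using (_≡_; _≢_)
open import Relation.Nullary using (¬_)
open import Data.Empty using (⊥)
open import Data.Fin using (_≟_)
open import Relation.Nullary.Decidable using (⌊_⌋)

record Graph : Set where
  field
    n     : ℕ
    adj   : Fin n → Fin n → Bool
    sym   : ∀ u v → adj u v ≡ adj v u
    irrfl : ∀ v → adj v v ≡ false
open Graph public

count : ∀ {m} → (Fin m → Bool) → ℕ
count {zero}  f = 0
count {suc m} f = (if f zero then 1 else 0) + count (λ i → f (suc i))

VSet : Graph → Set
VSet G = Fin (n G) → Bool

allV : (G : Graph) → VSet G
allV G _ = true

remove : (G : Graph) → VSet G → Fin (n G) → VSet G
remove G S v u = S u ∧ not ⌊ u ≟ v ⌋

data Reach (G : Graph) (S : VSet G) (u : Fin (n G)) : Fin (n G) → Set where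
  here : S u ≡ true → Reach G S u u
  step : ∀ {w v} → Reach G S u w → adj G w v ≡ true → S v ≡ true → Reach G S u v

Connected : (G : Graph) → VSet G → Set
Connected G S = ∀ u v → S u ≡ true → S v ≡ true → Reach G S u v

Nonseparable : (G : Graph) → VSet G → Set
Nonseparable G S = Connected G S × (∀ v → S v ≡ true → Connected G (remove G S v))

Sub : (G : Graph) → VSet G → VSet G → Set
Sub G S T = ∀ u → S u ≡ true → T u ≡ true

IsBlock : (G : Graph) → VSet G → Set
IsBlock G S = (∃ λ u → S u ≡ true) × Nonseparable G S
            × (∀ T → Sub G S T → Nonseparable G T → Sub G T S)

-- v is a cut vertex of G: removing v disconnects two vertices that were
-- connected in G (i.e. the number of components increases).
IsCutVertex : (G : Graph) → Fin (n G) → Set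
IsCutVertex G v = Σ (Fin (n G)) λ a → Σ (Fin (n G)) λ b →
  a ≢ v × b ≢ v × Reach G (allV G) a b × ¬ Reach G (remove G (allV G) v) a b

IsBlockGraph : Graph → Set
IsBlockGraph G = ∀ S → IsBlock G S →
  ∀ u v → S u ≡ true → S v ≡ true → u ≢ v → adj G u v ≡ true

-- Every block has exactly k vertices (for a block graph this forces ω(G) = k).
IsUniform : ℕ → Graph → Set
IsUniform k G = ∀ S → IsBlock G S → count S ≡ k

AtMostTwoCutVerticesPerBlock : Graph → Set
AtMostTwoCutVerticesPerBlock G = ∀ S → IsBlock G S →
  ∀ a b c → a ≢ b → a ≢ c → b ≢ c →
  S a ≡ true → S b ≡ true → S c ≡ true →
  IsCutVertex G a → IsCutVertex G b → IsCutVertex G c → ⊥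

record Orientation (G : Graph) : Set where
  field
    arc      : Fin (n G) → Fin (n G) → Bool
    arc⇒adj  : ∀ u v → arc u v ≡ true → adj G u v ≡ true
    oneway   : ∀ u v → adj G u v ≡ true → arc v u ≡ not (arc u v)
open Orientation public

indeg : {G : Graph} → Orientation G → Fin (n G) → ℕ
indeg D v = count (λ u → arc D u v)

IsProper : {G : Graph} → Orientation G → Set
IsProper {G} D = ∀ u v → adj G u v ≡ true → indeg D u ≢ indeg D v

HasProperOrientation : ℕ → Graph → Set
HasProperOrientation k G = Σ (Orientation G) λ D → IsProper D × (∀ v → indeg D v ≤ k)

-- χ→(G) ≥ m  (χ→ is the least k with a proper k-orientation),
-- i.e. there is no proper k-orientation for any k < m.
ProperOrientationNumber≥ : Graph → ℕ → Set
ProperOrientationNumber≥ G m = ∀ k → suc k ≤ m → ¬ HasProperOrientation k G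

-- In a proper orientation of maximum indegree k, a vertex h carrying k + 1 pendant k-cliques has
-- indegree 0 or k. Indeed, some pendant clique has all its edges at h directed away from h, so its
-- k − 1 other vertices have indegrees in [1, k − 1]; with h they form a k-clique, whose indegrees are
-- pairwise distinct, so d(h) cannot lie in [1, k − 1] as well. The graph is a tree of k-cliques: a root
-- joined by k + 1 blocks to hubs c_i, each c_i joined by k + 1 blocks to hubs g_ij, and each c_i, g_ij
-- carrying k + 1 pendant blocks. If d(c_i) = k, its k + 1 neighbours g_ij have indegree 0, hence all
-- point into c_i; so every c_i is a source, and then the k + 1 hubs c_i all point into the root.
module Submission where

open import Defs hiding (sym)
open import Level using (0ℓ)
open import Data.Nat using (ℕ; zero; suc; _+_; _*_; _≤_; z≤n; s≤s; s≤s⁻¹)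
open import Data.Nat.Properties using (_≤?_; ≤-trans; ≤-antisym; ≰⇒>; n<1+n; 1+n≰n)
open import Data.Fin using (Fin; zero; suc; fromℕ<; _≟_)
open import Data.Fin.Properties
  using ( injective⇒≤; suc-injective; any?; all?; ¬∀⟶∃¬; pigeonhole; fromℕ<-injective; <⇒≢
        ; +↔⊎; *↔×; 1↔⊤; inj⇒≟)
open import Data.Unit using (⊤; tt)
open import Data.Bool using (Bool; true; false; if_then_else_)
open import Data.Bool.Properties using (∧-zeroʳ; ¬-not) renaming (_≟_ to _≟ᵇ_)
open import Data.Empty using (⊥; ⊥-elim)
open import Data.Sum using (_⊎_; inj₁; inj₂)
open import Data.Sum.Properties using (inj₂-injective)
open import Data.Sum.Function.Propositional using (_⊎-↔_)
open import Data.Product using (Σ; ∃; ∃₂; _×_; _,_; proj₁; proj₂)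
open import Data.Product.Properties using (,-injectiveˡ; ,-injectiveʳ)
open import Data.Product.Function.NonDependent.Propositional using (_×-↔_)
open import Data.List using (List; []; _∷_)
open import Data.List.Relation.Unary.Any using (here; there)
open import Data.List.Membership.Propositional using (_∈_)
import Data.List.Membership.DecPropositional as Membership
open import Function using (_∘_; _↔_; Inverse; mk⇔)
open import Function.Definitions using (Injective)
open import Function.Properties.Inverse using (↔-refl; ↔-sym; ↔-trans; ↔⇒↣)
open import Relation.Nullary using (¬_; Dec; yes; no; does; contradiction)
open import Relation.Nullary.Decidable using (map′; _⊎-dec_; _×-dec_; ¬?; dec-true; dec-false; does-⇔)
open import Relation.Unary using (Pred; Decidable)
open import Relation.Binary using (DecidableEquality)
open import Relation.Binary.PropositionalEquality

does-sound : ∀ {A : Set} (a? : Dec A) → does a? ≡ true → A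
does-sound (yes a) _ = a

≡true⇔⇒≡ : ∀ {a b : Bool} → (a ≡ true → b ≡ true) → (b ≡ true → a ≡ true) → a ≡ b
≡true⇔⇒≡ {false} {false} _   _   = refl
≡true⇔⇒≡ {false} {true}  _   b⇒a = b⇒a refl
≡true⇔⇒≡ {true}  {false} a⇒b _   = sym (a⇒b refl)
≡true⇔⇒≡ {true}  {true}  _   _   = refl

count-cong : ∀ {m} {f g : Fin m → Bool} → (∀ x → f x ≡ g x) → count f ≡ count g
count-cong {zero}      f≗g = refl
count-cong {suc m} {f} f≗g rewrite f≗g zero = cong (_ +_) (count-cong (f≗g ∘ suc))

rank : ∀ {m} (f : Fin m → Bool) (x : Fin m) → f x ≡ true → Fin (count f)
rank f zero fx with f zero
... | true = zero
rank f (suc x) fx with f zero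
... | true  = suc (rank (f ∘ suc) x fx)
... | false = rank (f ∘ suc) x fx

rank-injective : ∀ {m} (f : Fin m → Bool) {x y : Fin m} (fx : f x ≡ true) (fy : f y ≡ true) →
                 rank f x fx ≡ rank f y fy → x ≡ y
rank-injective f {zero}  {zero}  fx fy eq = refl
rank-injective f {zero}  {suc y} fx fy eq with f zero
rank-injective f {zero}  {suc y} fx fy () | true
rank-injective f {suc x} {zero}  fx fy eq with f zero
rank-injective f {suc x} {zero}  fx fy () | true
rank-injective f {suc x} {suc y} fx fy eq with f zero
... | true  = cong suc (rank-injective (f ∘ suc) fx fy (suc-injective eq))
... | false = cong suc (rank-injective (f ∘ suc) fx fy eq)

select : ∀ {m} (f : Fin m → Bool) → Fin (count f) → Fin m
select {suc m} f a with f zero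
select {suc m} f zero    | true  = zero
select {suc m} f (suc a) | true  = suc (select (f ∘ suc) a)
select {suc m} f a       | false = suc (select (f ∘ suc) a)

select-true : ∀ {m} (f : Fin m → Bool) (a : Fin (count f)) → f (select f a) ≡ true
select-true {suc m} f a with f zero in f0
select-true {suc m} f zero    | true  = f0
select-true {suc m} f (suc a) | true  = select-true (f ∘ suc) a
select-true {suc m} f a       | false = select-true (f ∘ suc) a

select-injective : ∀ {m} (f : Fin m → Bool) → Injective _≡_ _≡_ (select f)
select-injective {suc m} f {a} {b} eq with f zero
select-injective {suc m} f {zero}  {zero}  eq | true  = refl
select-injective {suc m} f {suc a} {suc b} eq | true  = cong suc (select-injective (f ∘ suc) (suc-injective eq))
select-injective {suc m} f {a}     {b}     eq | false = select-injective (f ∘ suc) (suc-injective eq)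

count-≥-injective : ∀ {m j} {f : Fin m → Bool} (ι : Fin j → Fin m) → Injective _≡_ _≡_ ι →
                    (∀ a → f (ι a) ≡ true) → j ≤ count f
count-≥-injective {f = f} ι ι-inj fι = injective⇒≤ (ι-inj ∘ rank-injective f (fι _) (fι _))

count-≤-covering : ∀ {m j} {f : Fin m → Bool} (ι : Fin j → Fin m) →
                   (∀ x → f x ≡ true → ∃ λ a → ι a ≡ x) → count f ≤ j
count-≤-covering {j = j} {f = f} ι covers = injective⇒≤ {f = preimage} preimage-injective
  where
  preimage : Fin (count f) → Fin j
  preimage a = proj₁ (covers (select f a) (select-true f a))
  preimage-injective : Injective _≡_ _≡_ preimage
  preimage-injective {a} {b} eq = select-injective f (begin
    select f a      ≡⟨ sym (proj₂ (covers _ (select-true f a))) ⟩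
    ι (preimage a)  ≡⟨ cong ι eq ⟩
    ι (preimage b)  ≡⟨ proj₂ (covers _ (select-true f b)) ⟩
    select f b      ∎)
    where open ≡-Reasoning

module _ {G : Graph} {S : VSet G} where

  Reach-target : ∀ {u v} → Reach G S u v → S v ≡ true
  Reach-target (here Sv)     = Sv
  Reach-target (step _ _ Sv) = Sv

  Reach-trans : ∀ {u w v} → Reach G S u w → Reach G S w v → Reach G S u v
  Reach-trans u⇝w (here _)           = u⇝w
  Reach-trans u⇝w (step w⇝v′ v′v Sv) = step (Reach-trans u⇝w w⇝v′) v′v Sv

  Reach-sym : ∀ {u v} → Reach G S u v → Reach G S v u
  Reach-sym (here Su)        = here Su
  Reach-sym (step u⇝w wv Sv) =
    Reach-trans (step (here Sv) (trans (Graph.sym G _ _) wv) (Reach-target u⇝w)) (Reach-sym u⇝w)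

  Reach-leaving-visits : ∀ {σ : Pred (Fin (n G)) 0ℓ} → Decidable σ → ∀ {x} →
    (∀ {w w′} → adj G w w′ ≡ true → σ w → ¬ σ w′ → w′ ≡ x) →
    ∀ {u v} → Reach G S u v → σ u → ¬ σ v → S x ≡ true
  Reach-leaving-visits σ? exit (here _) σu ¬σv = contradiction σu ¬σv
  Reach-leaving-visits σ? exit (step {w} u⇝w wv Sv) σu ¬σv with σ? w
  ... | yes σw = subst (λ z → S z ≡ true) (exit wv σw ¬σv) Sv
  ... | no ¬σw = Reach-leaving-visits σ? exit u⇝w σu ¬σw

module _ (G : Graph) (S : VSet G) where

  remove-self : ∀ x → remove G S x x ≡ false
  remove-self x with x ≟ x
  ... | yes _   = ∧-zeroʳ (S x)
  ... | no  x≢x = contradiction refl x≢x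

  remove-⊆ : ∀ {x y} → remove G S x y ≡ true → S y ≡ true
  remove-⊆ {x} {y} Ry with S y
  ... | true  = refl
  ... | false = Ry

  remove-∈ : ∀ {x y} → S y ≡ true → y ≢ x → remove G S x y ≡ true
  remove-∈ {x} {y} Sy y≢x rewrite Sy with y ≟ x
  ... | yes y≡x = contradiction y≡x y≢x
  ... | no  _   = refl

IsClique : (G : Graph) → VSet G → Set
IsClique G S = ∀ u v → S u ≡ true → S v ≡ true → u ≢ v → adj G u v ≡ true

clique⇒connected : ∀ {G S} → IsClique G S → Connected G S
clique⇒connected clique u v Su Sv with u ≟ v
... | yes refl = here Su
... | no  u≢v  = step (here Su) (clique u v Su Sv u≢v) Sv

clique⇒nonseparable : ∀ {G S} → IsClique G S → Nonseparable G S
clique⇒nonseparable {G} {S} clique =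
  clique⇒connected clique ,
  λ x _ → clique⇒connected λ u v Ru Rv → clique u v (remove-⊆ G S Ru) (remove-⊆ G S Rv)

-- A u–v walk inside S, or inside S − x when x ∈ S, would have to visit x.
nonseparable-¬cut : ∀ {G S} → Nonseparable G S →
  ∀ {σ : Pred (Fin (n G)) 0ℓ} → Decidable σ → ∀ {x} →
  (∀ {w w′} → adj G w w′ ≡ true → σ w → ¬ σ w′ → w′ ≡ x) →
  ∀ {u v} → S u ≡ true → S v ≡ true → u ≢ x → v ≢ x → σ u → ¬ σ v → ⊥
nonseparable-¬cut {G} {S} (connected , 2-connected) σ? {x} exit {u} {v} Su Sv u≢x v≢x σu ¬σv
  with S x in Sx
... | false = contradiction (trans (sym Sx) (Reach-leaving-visits σ? exit (connected u v Su Sv) σu ¬σv)) λ ()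
... | true  = contradiction (trans (sym (remove-self G S x)) (Reach-leaving-visits σ? exit u⇝v σu ¬σv)) λ ()
  where
  u⇝v : Reach G (remove G S x) u v
  u⇝v = 2-connected x Sx u v (remove-∈ G S Su u≢x) (remove-∈ G S Sv v≢x)

module _ {G : Graph} (D : Orientation G) where

  arc-reverse : ∀ {u v} → adj G u v ≡ true → arc D u v ≡ false → arc D v u ≡ true
  arc-reverse {u} {v} uv ¬uv rewrite oneway D u v uv | ¬uv = refl

  arc⇒indeg-positive : ∀ {u v} → arc D u v ≡ true → 1 ≤ indeg D v
  arc⇒indeg-positive {u} uv =
    count-≥-injective {j = 1} (λ _ → u) (λ { {zero} {zero} _ → refl }) (λ _ → uv)

  source-arc : ∀ {u v} → indeg D v ≡ 0 → adj G u v ≡ true → arc D v u ≡ true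
  source-arc {u} {v} v-source uv with arc D u v in u→v
  ... | true  = contradiction (subst (1 ≤_) v-source (arc⇒indeg-positive u→v)) λ ()
  ... | false = arc-reverse uv u→v

private
  slotOf : ∀ {M a} → 1 ≤ a × a ≤ M → Fin M
  slotOf {a = suc a} (_ , a<M) = fromℕ< a<M

  slotOf-injective : ∀ {M a b} (ra : 1 ≤ a × a ≤ M) (rb : 1 ≤ b × b ≤ M) →
                     slotOf ra ≡ slotOf rb → a ≡ b
  slotOf-injective {a = suc a} {suc b} (_ , a<M) (_ , b<M) eq = cong suc (fromℕ<-injective a b a<M b<M eq)

¬clique-indegrees-in-[1,M] : ∀ {G M} (D : Orientation G) → IsProper D →
  (w : Fin (suc M) → Fin (n G)) → (∀ {i j} → i ≢ j → adj G (w i) (w j) ≡ true) →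
  ¬ (∀ i → 1 ≤ indeg D (w i) × indeg D (w i) ≤ M)
¬clique-indegrees-in-[1,M] {M = M} D proper w clique in-range =
  let i , j , i<j , same-slot = pigeonhole (n<1+n M) (slotOf ∘ in-range)
  in  proper (w i) (w j) (clique (<⇒≢ i<j)) (slotOf-injective (in-range i) (in-range j) same-slot)

-- Each clique vertex a forms a pendant block together with h.
record PendantCliques (G : Graph) (h : Fin (n G)) (k M : ℕ) : Set where
  field
    vertex    : Fin k → Fin M → Fin (n G)
    injective : ∀ {a b p q} → vertex a p ≡ vertex b q → a ≡ b × p ≡ q
    hub-adj   : ∀ a p → adj G h (vertex a p) ≡ true
    clique    : ∀ a {p q} → p ≢ q → adj G (vertex a p) (vertex a q) ≡ true
    closed    : ∀ {y} a p → adj G y (vertex a p) ≡ true → y ≡ h ⊎ ∃ λ q → y ≡ vertex a q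

≡0⊎≡suc-if-outside-[1,M] : ∀ {d M} → d ≤ suc M → ¬ (1 ≤ d × d ≤ M) → d ≡ 0 ⊎ d ≡ suc M
≡0⊎≡suc-if-outside-[1,M] {zero}      _     _       = inj₁ refl
≡0⊎≡suc-if-outside-[1,M] {suc d} {M} d≤1+M outside with suc d ≤? M
... | yes d<M = contradiction (s≤s z≤n , d<M) outside
... | no  d≮M = inj₂ (≤-antisym d≤1+M (≰⇒> d≮M))

module _ {G : Graph} {M : ℕ} (D : Orientation G) (proper : IsProper D)
         (bounded : ∀ v → indeg D v ≤ suc M) where

  ¬many-in-arcs : ∀ {h} (ι : Fin (suc (suc M)) → Fin (n G)) → Injective _≡_ _≡_ ι →
                  ¬ (∀ a → arc D (ι a) h ≡ true)
  ¬many-in-arcs {h} ι ι-injective in-arcs =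
    1+n≰n (≤-trans (count-≥-injective ι ι-injective in-arcs) (bounded h))

  ¬many-sources-around : ∀ {h} (ι : Fin (suc (suc M)) → Fin (n G)) → Injective _≡_ _≡_ ι →
                         (∀ a → adj G h (ι a) ≡ true) → ¬ (∀ a → indeg D (ι a) ≡ 0)
  ¬many-sources-around ι ι-injective adjacent sources =
    ¬many-in-arcs ι ι-injective (λ a → source-arc D (sources a) (adjacent a))

  pendant-dichotomy : ∀ {h} → PendantCliques G h (suc (suc M)) M → indeg D h ≡ 0 ⊎ indeg D h ≡ suc M
  pendant-dichotomy {h} P =
    ≡0⊎≡suc-if-outside-[1,M] (bounded h) λ h-in-range →
      ¬clique-indegrees-in-[1,M] D proper w w-clique (w-in-range h-in-range)
    where
    open PendantCliques P

    -- Otherwise every pendant clique sends an arc to h, giving h too many in-arcs.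
    out-clique : ∃ λ a → ∀ p → arc D h (vertex a p) ≡ true
    out-clique with any? (λ a → all? (λ p → arc D h (vertex a p) ≟ᵇ true))
    ... | yes found = found
    ... | no  none  = ⊥-elim (¬many-in-arcs ι (proj₁ ∘ injective) in-arcs)
      where
      witness : ∀ a → ∃ λ p → arc D h (vertex a p) ≢ true
      witness a = ¬∀⟶∃¬ _ _ (λ p → _ ≟ᵇ true) (λ all → none (a , all))
      ι : Fin (suc (suc M)) → Fin (n G)
      ι a = vertex a (proj₁ (witness a))
      in-arcs : ∀ a → arc D (ι a) h ≡ true
      in-arcs a = arc-reverse D (hub-adj a _) (¬-not (proj₂ (witness a)))

    a : Fin (suc (suc M))
    a = proj₁ out-clique

    w : Fin (suc M) → Fin (n G)
    w zero    = h
    w (suc p) = vertex a p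

    w-clique : ∀ {i j} → i ≢ j → adj G (w i) (w j) ≡ true
    w-clique {zero}  {zero}  0≢0 = contradiction refl 0≢0
    w-clique {zero}  {suc q} _   = hub-adj a q
    w-clique {suc p} {zero}  _   = trans (Graph.sym G _ _) (hub-adj a p)
    w-clique {suc p} {suc q} p≢q = clique a (p≢q ∘ cong suc)

    -- The in-neighbours of vertex a p lie in its clique with vertex a p itself replaced by h.
    indeg-≤ : ∀ p → indeg D (vertex a p) ≤ M
    indeg-≤ p = count-≤-covering neighbour covers
      where
      neighbour : Fin M → Fin (n G)
      neighbour q = if does (q ≟ p) then h else vertex a q
      covers : ∀ y → arc D y (vertex a p) ≡ true → ∃ λ q → neighbour q ≡ y
      covers y y→v with closed a p (arc⇒adj D y _ y→v)
      ... | inj₁ refl = p , cong (λ b → if b then h else vertex a p) (dec-true (p ≟ p) refl)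
      ... | inj₂ (q , refl) with q ≟ p
      ...   | yes refl = contradiction (trans (sym (irrfl G _)) (arc⇒adj D _ _ y→v)) λ ()
      ...   | no  q≢p  = q , cong (λ b → if b then h else vertex a q) (dec-false (q ≟ p) q≢p)

    w-in-range : 1 ≤ indeg D h × indeg D h ≤ M → ∀ i → 1 ≤ indeg D (w i) × indeg D (w i) ≤ M
    w-in-range h-in-range zero    = h-in-range
    w-in-range h-in-range (suc p) = arc⇒indeg-positive D (proj₂ out-clique p) , indeg-≤ p

  hub-source : ∀ {h} → indeg D h ≡ 0 ⊎ indeg D h ≡ suc M →
               (ι : Fin (suc (suc M)) → Fin (n G)) → Injective _≡_ _≡_ ι →
               (∀ a → adj G h (ι a) ≡ true) →
               (∀ a → indeg D (ι a) ≡ 0 ⊎ indeg D (ι a) ≡ suc M) → indeg D h ≡ 0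
  hub-source (inj₁ h-source) _ _ _ _ = h-source
  hub-source {h} (inj₂ h-full) ι ι-injective adjacent dichotomous =
    ⊥-elim (¬many-sources-around ι ι-injective adjacent source)
    where
    source : ∀ a → indeg D (ι a) ≡ 0
    source a with dichotomous a
    ... | inj₁ ι-source = ι-source
    ... | inj₂ ι-full   = contradiction (trans h-full (sym ι-full)) (proper h (ι a) (adjacent a))

module Construction (m : ℕ) where

  M : ℕ
  M = suc m

  K : ℕ
  K = suc (suc M)

  Block : Set
  Block = Fin K ⊎ (Fin K × Fin K) ⊎ (Fin K × Fin K) ⊎ (Fin K × Fin K × Fin K)

  pattern link₁ i     = inj₁ i
  pattern leaf₁ i j   = inj₂ (inj₁ (i , j))
  pattern link₂ i j   = inj₂ (inj₂ (inj₁ (i , j)))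
  pattern leaf₂ i j l = inj₂ (inj₂ (inj₂ (i , j , l)))

  -- The block b is the clique on parent b and own b 0, …, own b (M − 1), where M + 1 = k; the hubs
  -- c_i and g_ij of the construction are hub₁ i and hub₂ i j.
  Vertex : Set
  Vertex = ⊤ ⊎ (Block × Fin M)

  pattern root    = inj₁ tt
  pattern own b p = inj₂ (b , p)

  hub₁ : Fin K → Vertex
  hub₁ i = own (link₁ i) zero

  hub₂ : Fin K → Fin K → Vertex
  hub₂ i j = own (link₂ i j) zero

  parent : Block → Vertex
  parent (link₁ i)     = root
  parent (leaf₁ i j)   = hub₁ i
  parent (link₂ i j)   = hub₁ i
  parent (leaf₂ i j l) = hub₂ i j

  B : ℕ
  B = K + (K * K + (K * K + K * (K * K)))

  N : ℕ
  N = 1 + B * M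

  abstract
    Block↔Fin : Block ↔ Fin B
    Block↔Fin = ↔-sym (↔-trans +↔⊎ (↔-refl ⊎-↔ ↔-trans +↔⊎ (*↔× ⊎-↔ ↔-trans +↔⊎
                         (*↔× ⊎-↔ ↔-trans *↔× (↔-refl ×-↔ *↔×)))))

    Vertex↔Fin : Vertex ↔ Fin N
    Vertex↔Fin = ↔-sym (↔-trans +↔⊎ (1↔⊤ ⊎-↔ ↔-trans *↔× (↔-sym Block↔Fin ×-↔ ↔-refl)))

  _≟ᴮ_ : DecidableEquality Block
  _≟ᴮ_ = inj⇒≟ (↔⇒↣ Block↔Fin)

  _≟ⱽ_ : DecidableEquality Vertex
  _≟ⱽ_ = inj⇒≟ (↔⇒↣ Vertex↔Fin)

  any-block? : {P : Block → Set} → (∀ b → Dec (P b)) → Dec (∃ P)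
  any-block? {P} P? =
    map′ (λ (x , Px) → from x , Px) (λ (b , Pb) → to b , subst P (sym (strictlyInverseʳ b)) Pb) (any? (P? ∘ from))
    where open Inverse Block↔Fin

  open Inverse Vertex↔Fin public using () renaming
    (to to encode; from to decode; strictlyInverseˡ to encode-decode; strictlyInverseʳ to decode-encode)

  open Membership _≟ᴮ_ using (_∈?_)

  -- ancestors b lists the block owning parent b, the block owning its parent, and so on; b ≼ b′ says
  -- that b lies in the subtree hanging from b′.
  ancestors : Block → List Block
  ancestors (link₁ i)     = []
  ancestors (leaf₁ i j)   = link₁ i ∷ []
  ancestors (link₂ i j)   = link₁ i ∷ []
  ancestors (leaf₂ i j l) = link₂ i j ∷ link₁ i ∷ []

  infix 4 _≼_
  _≼_ : Block → Block → Set
  b ≼ b′ = b′ ∈ b ∷ ancestors b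

  ≼-refl : ∀ {b} → b ≼ b
  ≼-refl = here refl

  ≼-trans : ∀ {b₁ b₂ b₃} → b₁ ≼ b₂ → b₂ ≼ b₃ → b₁ ≼ b₃
  ≼-trans                 (here refl)                 b₂≼b₃ = b₂≼b₃
  ≼-trans {leaf₁ _ _}     (there (here refl))         b₂≼b₃ = there b₂≼b₃
  ≼-trans {link₂ _ _}     (there (here refl))         b₂≼b₃ = there b₂≼b₃
  ≼-trans {leaf₂ _ _ _}   (there (here refl))         b₂≼b₃ = there b₂≼b₃
  ≼-trans {leaf₂ _ _ _}   (there (there (here refl))) b₂≼b₃ = there (there b₂≼b₃)

  ≼-antisym : ∀ {b b′} → b ≼ b′ → b′ ≼ b → b ≡ b′
  ≼-antisym (here refl) _ = refl
  ≼-antisym _ (here refl) = refl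
  ≼-antisym {leaf₁ _ _}   (there (here refl))         (there ())
  ≼-antisym {link₂ _ _}   (there (here refl))         (there ())
  ≼-antisym {leaf₂ _ _ _} (there (here refl))         (there (here ()))
  ≼-antisym {leaf₂ _ _ _} (there (here refl))         (there (there ()))
  ≼-antisym {leaf₂ _ _ _} (there (there (here refl))) (there ())

  parent⇒≼ : ∀ {b b′ p} → parent b ≡ own b′ p → b ≼ b′
  parent⇒≼ {leaf₁ _ _}   refl = there (here refl)
  parent⇒≼ {link₂ _ _}   refl = there (here refl)
  parent⇒≼ {leaf₂ _ _ _} refl = there (here refl)

  ≼-parent : ∀ {b b′} → b ≼ b′ → b ≢ b′ → ∃₂ λ b″ p → parent b ≡ own b″ p × b″ ≼ b′
  ≼-parent (here refl) b≢b = contradiction refl b≢b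
  ≼-parent {leaf₁ _ _}   (there (here refl))         _ = _ , zero , refl , ≼-refl
  ≼-parent {link₂ _ _}   (there (here refl))         _ = _ , zero , refl , ≼-refl
  ≼-parent {leaf₂ _ _ _} (there (here refl))         _ = _ , zero , refl , ≼-refl
  ≼-parent {leaf₂ _ _ _} (there (there (here refl))) _ = _ , zero , refl , there (here refl)

  parent-⋠ : ∀ {b b′ p} → parent b ≡ own b′ p → ¬ b′ ≼ b
  parent-⋠ {leaf₁ _ _}   refl (here ())
  parent-⋠ {leaf₁ _ _}   refl (there ())
  parent-⋠ {link₂ _ _}   refl (here ())
  parent-⋠ {link₂ _ _}   refl (there ())
  parent-⋠ {leaf₂ _ _ _} refl (here ())
  parent-⋠ {leaf₂ _ _ _} refl (there (here ()))
  parent-⋠ {leaf₂ _ _ _} refl (there (there ()))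

  parent≢own : ∀ b p → parent b ≢ own b p
  parent≢own b p e = parent-⋠ e ≼-refl

  OnBlock : Block → Vertex → Set
  OnBlock b v = v ≡ parent b ⊎ ∃ λ p → v ≡ own b p

  abstract
    onBlock? : ∀ b v → Dec (OnBlock b v)
    onBlock? b v = (v ≟ⱽ parent b) ⊎-dec any? (λ p → v ≟ⱽ own b p)

  parent-on : ∀ b → OnBlock b (parent b)
  parent-on b = inj₁ refl

  own-on : ∀ b p → OnBlock b (own b p)
  own-on b p = inj₂ (p , refl)

  Adjacent : Vertex → Vertex → Set
  Adjacent u v = u ≢ v × ∃ λ b → OnBlock b u × OnBlock b v

  abstract
    adjacent? : ∀ u v → Dec (Adjacent u v)
    adjacent? u v = ¬? (u ≟ⱽ v) ×-dec any-block? (λ b → onBlock? b u ×-dec onBlock? b v)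

  Adjacent-sym : ∀ {u v} → Adjacent u v → Adjacent v u
  Adjacent-sym (u≢v , b , u-on , v-on) = u≢v ∘ sym , b , v-on , u-on

  on-block-adjacent : ∀ {b u v} → OnBlock b u → OnBlock b v → u ≢ v → Adjacent u v
  on-block-adjacent u-on v-on u≢v = u≢v , _ , u-on , v-on

  -- Below b v : v is one of the vertices hanging from parent b through the block b.
  Below : Block → Vertex → Set
  Below b root       = ⊥
  Below b (own b′ _) = b′ ≼ b

  below? : ∀ b v → Dec (Below b v)
  below? b root       = no λ ()
  below? b (own b′ _) = b ∈? b′ ∷ ancestors b′

  Below-exit : ∀ {b w w′} → Adjacent w w′ → Below b w → ¬ Below b w′ → w′ ≡ parent b
  Below-exit (_ , b″ , inj₂ (_ , refl) , inj₂ (_ , refl)) w↓ ¬w′↓ = contradiction w↓ ¬w′↓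
  Below-exit {b} (_ , b″ , inj₂ (_ , refl) , inj₁ refl) w↓ ¬w′↓ with b″ ≟ᴮ b
  ... | yes refl = refl
  ... | no  b″≢b =
    let _ , _ , e , b‴≼b = ≼-parent w↓ b″≢b in contradiction (subst (Below b) (sym e) b‴≼b) ¬w′↓
  Below-exit {b} {own b₁ _} (_ , b″ , inj₁ e , w′-on) w↓ ¬w′↓ with w′-on
  ... | inj₂ (_ , refl) = contradiction (≼-trans (parent⇒≼ (sym e)) w↓) ¬w′↓
  ... | inj₁ e′         = contradiction (subst (Below b) (trans e (sym e′)) w↓) ¬w′↓

  -- Cuts b u v : parent b is a cut vertex separating u (below b) from v.
  Cuts : Block → Vertex → Vertex → Set
  Cuts b u v = parent b ≢ u × parent b ≢ v × Below b u × ¬ Below b v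

  own-cuts : ∀ {b p v} → own b p ≢ v → ¬ Adjacent (own b p) v → ¬ Below b v → Cuts b (own b p) v
  own-cuts {b} {p} u≢v ¬adj ¬v↓ =
    parent≢own b p , (λ e → ¬adj (on-block-adjacent (own-on b p) (subst (OnBlock b) e (parent-on b)) u≢v)) ,
    ≼-refl , ¬v↓

  cutting-block : ∀ {u v} → u ≢ v → ¬ Adjacent u v → ∃ λ b → Cuts b u v ⊎ Cuts b v u
  cutting-block {root}     {root}     u≢v _    = contradiction refl u≢v
  cutting-block {root}     {own b q}  u≢v ¬adj = b , inj₂ (own-cuts (u≢v ∘ sym) (¬adj ∘ Adjacent-sym) λ ())
  cutting-block {own b p}  {v}        u≢v ¬adj with below? b v
  ... | no ¬v↓ = b , inj₁ (own-cuts u≢v ¬adj ¬v↓)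
  cutting-block {own b p}  {own b₁ q} u≢v ¬adj | yes b₁≼b with below? b₁ (own b p)
  ... | no ¬u↓   = b₁ , inj₂ (own-cuts (u≢v ∘ sym) (¬adj ∘ Adjacent-sym) ¬u↓)
  ... | yes b≼b₁ with ≼-antisym b≼b₁ b₁≼b
  ...   | refl = contradiction (on-block-adjacent (own-on b p) (own-on b q) u≢v) ¬adj

  ¬Below-on-block : ∀ {b b₁ u} → OnBlock b u → b₁ ≼ b → b₁ ≢ b → ¬ Below b₁ u
  ¬Below-on-block {b} (inj₁ refl) b₁≼b _ u↓ with parent b in e
  ... | root    = u↓
  ... | own _ _ = parent-⋠ e (≼-trans u↓ b₁≼b)
  ¬Below-on-block (inj₂ (_ , refl)) b₁≼b b₁≢b b≼b₁ = b₁≢b (≼-antisym b₁≼b b≼b₁)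

  common-neighbour-on-block : ∀ {b u v w} → OnBlock b u → OnBlock b v → u ≢ v →
                              Adjacent w u → Adjacent w v → OnBlock b w
  common-neighbour-on-block {b} {u} {v} {w} u-on v-on u≢v wu wv with onBlock? b w
  ... | yes w-on = w-on
  ... | no ¬w-on with below? b w
  ...   | no ¬w↓ = inj₁ (exit u-on v-on)
    where
    exit : OnBlock b u → OnBlock b v → w ≡ parent b
    exit (inj₂ (_ , refl)) _                 = Below-exit (Adjacent-sym wu) ≼-refl ¬w↓
    exit (inj₁ _)          (inj₂ (_ , refl)) = Below-exit (Adjacent-sym wv) ≼-refl ¬w↓
    exit (inj₁ u≡pb)       (inj₁ v≡pb)       = contradiction (trans u≡pb (sym v≡pb)) u≢v
  common-neighbour-on-block {b} {u} {v} {own b₁ q} u-on v-on u≢v wu wv | no ¬w-on | yes b₁≼b =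
    contradiction (trans (Below-exit wu ≼-refl (¬Below-on-block u-on b₁≼b b₁≢b))
                         (sym (Below-exit wv ≼-refl (¬Below-on-block v-on b₁≼b b₁≢b)))) u≢v
    where
    b₁≢b : b₁ ≢ b
    b₁≢b refl = ¬w-on (own-on b q)

  G : Graph
  G = record
    { n     = N
    ; adj   = λ x y → does (adjacent? (decode x) (decode y))
    ; sym   = λ x y → does-⇔ (mk⇔ Adjacent-sym Adjacent-sym) (adjacent? _ _) (adjacent? _ _)
    ; irrfl = λ x → dec-false (adjacent? _ _) λ (x≢x , _) → x≢x refl
    }

  adj⇒Adjacent : ∀ {x y} → adj G x y ≡ true → Adjacent (decode x) (decode y)
  adj⇒Adjacent = does-sound (adjacent? _ _)

  Adjacent⇒adj : ∀ {x y} → Adjacent (decode x) (decode y) → adj G x y ≡ true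
  Adjacent⇒adj {x} {y} = dec-true (adjacent? (decode x) (decode y))

  Adjacent⇒adj-encode : ∀ {u v} → Adjacent u v → adj G (encode u) (encode v) ≡ true
  Adjacent⇒adj-encode {u} {v} uv =
    Adjacent⇒adj (subst₂ Adjacent (sym (decode-encode u)) (sym (decode-encode v)) uv)

  decode-injective : ∀ {x y} → decode x ≡ decode y → x ≡ y
  decode-injective {x} {y} e = trans (sym (encode-decode x)) (trans (cong encode e) (encode-decode y))

  encode-injective : ∀ {u v} → encode u ≡ encode v → u ≡ v
  encode-injective {u} {v} e = trans (sym (decode-encode u)) (trans (cong decode e) (decode-encode v))

  decode≡⇒≡encode : ∀ {x v} → decode x ≡ v → x ≡ encode v
  decode≡⇒≡encode {x} refl = sym (encode-decode x)

  ≡encode⇒decode≡ : ∀ {x v} → x ≡ encode v → decode x ≡ v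
  ≡encode⇒decode≡ {v = v} refl = decode-encode v

  cut⇒separable : ∀ {S b u v} → Cuts b (decode u) (decode v) → S u ≡ true → S v ≡ true →
                  ¬ Nonseparable G S
  cut⇒separable {b = b} (pb≢u , pb≢v , u↓ , ¬v↓) Su Sv nonsep =
    nonseparable-¬cut nonsep (λ y → below? b (decode y)) exit Su Sv
      (pb≢u ∘ sym ∘ ≡encode⇒decode≡) (pb≢v ∘ sym ∘ ≡encode⇒decode≡) u↓ ¬v↓
    where
    exit : ∀ {w w′} → adj G w w′ ≡ true → Below b (decode w) → ¬ Below b (decode w′) → w′ ≡ encode (parent b)
    exit ww′ w↓ ¬w′↓ = decode≡⇒≡encode (Below-exit (adj⇒Adjacent ww′) w↓ ¬w′↓)

  nonseparable⇒clique : ∀ {S} → Nonseparable G S → IsClique G S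
  nonseparable⇒clique {S} nonsep u v Su Sv u≢v with adjacent? (decode u) (decode v)
  ... | yes _    = refl
  ... | no  ¬adj with cutting-block (u≢v ∘ decode-injective) ¬adj
  ...   | _ , inj₁ cut = ⊥-elim (cut⇒separable cut Su Sv nonsep)
  ...   | _ , inj₂ cut = ⊥-elim (cut⇒separable cut Sv Su nonsep)

  blockSet : Block → VSet G
  blockSet b x = does (onBlock? b (decode x))

  blockSet-sound : ∀ {b x} → blockSet b x ≡ true → OnBlock b (decode x)
  blockSet-sound {b} {x} = does-sound (onBlock? b (decode x))

  blockSet-complete : ∀ {b x} → OnBlock b (decode x) → blockSet b x ≡ true
  blockSet-complete {b} {x} = dec-true (onBlock? b (decode x))

  blockSet-clique : ∀ b → IsClique G (blockSet b)
  blockSet-clique b x y bx by x≢y =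
    Adjacent⇒adj (on-block-adjacent (blockSet-sound bx) (blockSet-sound by) (x≢y ∘ decode-injective))

  some-block : ∀ v → ∃ λ b → OnBlock b v
  some-block root      = link₁ zero , parent-on (link₁ zero)
  some-block (own b p) = b , own-on b p

  block⇒blockSet : ∀ {S} → IsBlock G S → ∃ λ b → ∀ x → S x ≡ blockSet b x
  block⇒blockSet {S} ((u , Su) , nonsep , maximal) =
    let b , S⊆b = inside-blockSet
        b-inside-S = maximal (blockSet b) S⊆b (clique⇒nonseparable (blockSet-clique b))
    in  b , λ x → ≡true⇔⇒≡ (S⊆b x) (b-inside-S x)
    where
    clique : IsClique G S
    clique = nonseparable⇒clique nonsep
    inside-blockSet : ∃ λ b → Sub G S (blockSet b)
    inside-blockSet with any? (λ v → (S v ≟ᵇ true) ×-dec ¬? (v ≟ u))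
    ... | no ¬other with some-block (decode u)
    ...   | b , u-on = b , S⊆b
      where
      S⊆b : Sub G S (blockSet b)
      S⊆b y Sy with y ≟ u
      ... | yes refl = blockSet-complete u-on
      ... | no  y≢u  = contradiction (y , Sy , y≢u) ¬other
    inside-blockSet | yes (v , Sv , v≢u) with adj⇒Adjacent (clique u v Su Sv (v≢u ∘ sym))
    ...   | _ , b , u-on , v-on = b , S⊆b
      where
      S⊆b : Sub G S (blockSet b)
      S⊆b y Sy with y ≟ u | y ≟ v
      ... | yes refl | _        = blockSet-complete u-on
      ... | no _     | yes refl = blockSet-complete v-on
      ... | no y≢u   | no y≢v   =
        blockSet-complete (common-neighbour-on-block u-on v-on (v≢u ∘ sym ∘ decode-injective)
          (adj⇒Adjacent (clique y u Sy Su y≢u)) (adj⇒Adjacent (clique y v Sy Sv y≢v)))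

  on⇒blockSet : ∀ {b v} → OnBlock b v → blockSet b (encode v) ≡ true
  on⇒blockSet {b} {v} v-on = blockSet-complete (subst (OnBlock b) (sym (decode-encode v)) v-on)

  count-blockSet : ∀ b → count (blockSet b) ≡ suc M
  count-blockSet b =
    ≤-antisym (count-≤-covering ι covers) (count-≥-injective {f = blockSet b} ι ι-injective (on⇒blockSet ∘ ι-on))
    where
    vertexOf : Fin (suc M) → Vertex
    vertexOf zero    = parent b
    vertexOf (suc p) = own b p
    ι : Fin (suc M) → Fin N
    ι = encode ∘ vertexOf
    ι-on : ∀ a → OnBlock b (vertexOf a)
    ι-on zero    = parent-on b
    ι-on (suc p) = own-on b p
    ι-injective : Injective _≡_ _≡_ ι
    ι-injective {a} {a′} e with a | a′ | encode-injective e
    ... | zero  | zero  | _    = refl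
    ... | zero  | suc p | e′   = contradiction e′ (parent≢own b p)
    ... | suc p | zero  | e′   = contradiction (sym e′) (parent≢own b p)
    ... | suc p | suc q | refl = refl
    covers : ∀ x → blockSet b x ≡ true → ∃ λ a → ι a ≡ x
    covers x bx with blockSet-sound bx
    ... | inj₁ e       = zero  , sym (decode≡⇒≡encode e)
    ... | inj₂ (p , e) = suc p , sym (decode≡⇒≡encode e)

  parent-own-adjacent : ∀ b p → Adjacent (parent b) (own b p)
  parent-own-adjacent b p = on-block-adjacent (parent-on b) (own-on b p) (parent≢own b p)

  -- Only the first own vertex of a block is ever a parent, so removing any other one leaves the tree connected.
  own-suc-not-cut : ∀ b p → ¬ IsCutVertex G (encode (own b (suc p)))
  own-suc-not-cut b p (y , z , y≢x , z≢x , _ , ¬y⇝z) =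
    ¬y⇝z (Reach-trans (Reach-sym (root⇝ y y≢x)) (root⇝ z z≢x))
    where
    x : Vertex
    x = own b (suc p)
    R : VSet G
    R = remove G (allV G) (encode x)

    kept : ∀ {v} → v ≢ x → R (encode v) ≡ true
    kept v≢x = remove-∈ G (allV G) refl (v≢x ∘ encode-injective)

    down : ∀ {b′} q → own b′ q ≢ x → Reach G R (encode root) (encode (parent b′)) →
           Reach G R (encode root) (encode (own b′ q))
    down {b′} q v≢x root⇝parent =
      step root⇝parent (Adjacent⇒adj-encode (parent-own-adjacent b′ q)) (kept v≢x)

    root⇝hub₁ : ∀ i → Reach G R (encode root) (encode (hub₁ i))
    root⇝hub₁ i = down zero (λ ()) (here (kept λ ()))

    root⇝parent : ∀ b′ → Reach G R (encode root) (encode (parent b′))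
    root⇝parent (link₁ _)     = here (kept λ ())
    root⇝parent (leaf₁ i _)   = root⇝hub₁ i
    root⇝parent (link₂ i _)   = root⇝hub₁ i
    root⇝parent (leaf₂ i _ _) = down zero (λ ()) (root⇝hub₁ i)

    root⇝ : ∀ y → y ≢ encode x → Reach G R (encode root) y
    root⇝ y y≢x = subst (Reach G R (encode root)) (encode-decode y) (reach (decode y) (y≢x ∘ decode≡⇒≡encode))
      where
      reach : ∀ v → v ≢ x → Reach G R (encode root) (encode v)
      reach root        v≢x = here (kept v≢x)
      reach (own b′ q)  v≢x = down q v≢x (root⇝parent b′)

  at-most-two-cut-vertices : AtMostTwoCutVerticesPerBlock G
  at-most-two-cut-vertices S S-block a b c a≢b a≢c b≢c Sa Sb Sc cut-a cut-b cut-c =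
    two-of-three (position Sa cut-a) (position Sb cut-b) (position Sc cut-c)
    where
    β : Block
    β = proj₁ (block⇒blockSet S-block)

    position : ∀ {x} → S x ≡ true → IsCutVertex G x → decode x ≡ parent β ⊎ decode x ≡ own β zero
    position {x} Sx cut with blockSet-sound (trans (sym (proj₂ (block⇒blockSet S-block) x)) Sx)
    ... | inj₁ e           = inj₁ e
    ... | inj₂ (zero , e)  = inj₂ e
    ... | inj₂ (suc p , e) =
      ⊥-elim (own-suc-not-cut β p (subst (IsCutVertex G) (decode≡⇒≡encode e) cut))

    same : ∀ {x y w} → decode x ≡ w → decode y ≡ w → x ≡ y
    same x≡w y≡w = decode-injective (trans x≡w (sym y≡w))

    two-of-three : decode a ≡ parent β ⊎ decode a ≡ own β zero →
                   decode b ≡ parent β ⊎ decode b ≡ own β zero →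
                   decode c ≡ parent β ⊎ decode c ≡ own β zero → ⊥
    two-of-three (inj₁ a≡) (inj₁ b≡) _         = a≢b (same a≡ b≡)
    two-of-three (inj₂ a≡) (inj₂ b≡) _         = a≢b (same a≡ b≡)
    two-of-three (inj₁ a≡) _         (inj₁ c≡) = a≢c (same a≡ c≡)
    two-of-three (inj₂ a≡) _         (inj₂ c≡) = a≢c (same a≡ c≡)
    two-of-three _         (inj₁ b≡) (inj₁ c≡) = b≢c (same b≡ c≡)
    two-of-three _         (inj₂ b≡) (inj₂ c≡) = b≢c (same b≡ c≡)

  leaf-cliques : ∀ {h} (leaf : Fin K → Block) → Injective _≡_ _≡_ leaf →
                 (∀ a → parent (leaf a) ≡ h) → (∀ a p b → parent b ≢ own (leaf a) p) →
                 PendantCliques G (encode h) K M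
  leaf-cliques {h} leaf leaf-injective leaf-parent childless = record
    { vertex    = λ a p → encode (own (leaf a) p)
    ; injective = own-injective ∘ encode-injective
    ; hub-adj   = λ a p → Adjacent⇒adj-encode
                    (subst (λ v → Adjacent v (own (leaf a) p)) (leaf-parent a) (parent-own-adjacent (leaf a) p))
    ; clique    = λ a p≢q → Adjacent⇒adj-encode
                    (on-block-adjacent (own-on (leaf a) _) (own-on (leaf a) _) (p≢q ∘ proj₂ ∘ own-injective))
    ; closed    = closed
    }
    where
    own-injective : ∀ {a b p q} → own (leaf a) p ≡ own (leaf b) q → a ≡ b × p ≡ q
    own-injective e = leaf-injective (,-injectiveˡ (inj₂-injective e)) , ,-injectiveʳ (inj₂-injective e)
    closed : ∀ {y} a p → adj G y (encode (own (leaf a) p)) ≡ true →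
             y ≡ encode h ⊎ ∃ λ q → y ≡ encode (own (leaf a) q)
    closed {y} a p yv with subst (Adjacent (decode y)) (decode-encode _) (adj⇒Adjacent yv)
    ... | _ , _ , _            , inj₁ e          = contradiction (sym e) (childless a p _)
    ... | _ , _ , inj₁ e       , inj₂ (_ , refl) = inj₁ (decode≡⇒≡encode (trans e (leaf-parent a)))
    ... | _ , _ , inj₂ (q , e) , inj₂ (_ , refl) = inj₂ (q , decode≡⇒≡encode e)

  G-isBlockGraph : IsBlockGraph G
  G-isBlockGraph S (_ , nonsep , _) = nonseparable⇒clique nonsep

  G-isUniform : IsUniform (suc M) G
  G-isUniform S S-block = let b , S≗b = block⇒blockSet S-block in trans (count-cong S≗b) (count-blockSet b)

  ¬proper-orientation : (D : Orientation G) → IsProper D → ¬ (∀ v → indeg D v ≤ suc M)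
  ¬proper-orientation D proper bounded =
    ¬many-sources-around D proper bounded (encode ∘ hub₁) hub₁-injective
      (λ i → Adjacent⇒adj-encode (parent-own-adjacent (link₁ i) zero)) hub₁-source
    where
    hub₁-injective : Injective _≡_ _≡_ (encode ∘ hub₁)
    hub₁-injective e with encode-injective e
    ... | refl = refl

    hub₂-injective : ∀ i → Injective _≡_ _≡_ (encode ∘ hub₂ i)
    hub₂-injective i e with encode-injective e
    ... | refl = refl

    leaf₁-childless : ∀ i j p b → parent b ≢ own (leaf₁ i j) p
    leaf₁-childless i j p (link₁ _)     ()
    leaf₁-childless i j p (leaf₁ _ _)   ()
    leaf₁-childless i j p (link₂ _ _)   ()
    leaf₁-childless i j p (leaf₂ _ _ _) ()

    leaf₂-childless : ∀ i j l p b → parent b ≢ own (leaf₂ i j l) p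
    leaf₂-childless i j l p (link₁ _)     ()
    leaf₂-childless i j l p (leaf₁ _ _)   ()
    leaf₂-childless i j l p (link₂ _ _)   ()
    leaf₂-childless i j l p (leaf₂ _ _ _) ()

    hub₂-dichotomy : ∀ i j → indeg D (encode (hub₂ i j)) ≡ 0 ⊎ indeg D (encode (hub₂ i j)) ≡ suc M
    hub₂-dichotomy i j = pendant-dichotomy D proper bounded
      (leaf-cliques (leaf₂ i j) (λ { refl → refl }) (λ _ → refl) (leaf₂-childless i j))

    hub₁-dichotomy : ∀ i → indeg D (encode (hub₁ i)) ≡ 0 ⊎ indeg D (encode (hub₁ i)) ≡ suc M
    hub₁-dichotomy i = pendant-dichotomy D proper bounded
      (leaf-cliques (leaf₁ i) (λ { refl → refl }) (λ _ → refl) (leaf₁-childless i))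

    hub₁-source : ∀ i → indeg D (encode (hub₁ i)) ≡ 0
    hub₁-source i = hub-source D proper bounded (hub₁-dichotomy i) (encode ∘ hub₂ i) (hub₂-injective i)
      (λ j → Adjacent⇒adj-encode (parent-own-adjacent (link₂ i j) zero)) (hub₂-dichotomy i)

  G-properOrientationNumber : ProperOrientationNumber≥ G (suc (suc M))
  G-properOrientationNumber k k<M+2 (D , proper , bounded) =
    ¬proper-orientation D proper (λ v → ≤-trans (bounded v) (s≤s⁻¹ k<M+2))

proposition24 : (k : ℕ) → 2 ≤ k →
    Σ Graph λ G → IsBlockGraph G × IsUniform k G
      × AtMostTwoCutVerticesPerBlock G × ProperOrientationNumber≥ G (suc k)
proposition24 0             ()
proposition24 1             (s≤s ())
proposition24 (suc (suc m)) _ =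
  G , G-isBlockGraph , G-isUniform , at-most-two-cut-vertices , G-properOrientationNumber
  where open Construction m
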